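{- For any integers $\beta,n,\rho \geq 0$ and $\alpha > 0$, $$C^2_{n,(\alpha,\beta),\rho} = \begin{cases} \displaystyle{\sum_{i=0}^{\min(\alpha-1,\beta-1)}} \frac{\alpha+\beta-1-2i}{2n+\beta-\alpha+1} \binom{2n+\beta-\alpha+1}{n-\alpha+1+i} & \text{ if } \rho = 0, \\[12pt] \displaystyle{\frac{\alpha+\beta+\rho-1}{2n+\beta-\alpha-\rho+1} \binom{2n+\beta-\alpha-\rho+1}{n-\alpha-\rho+1}} & \text{ if } \rho > 0. \end{cases}$$
   Context: For integers $\alpha,\beta, n\ge 0$, consider the integer lattice paths from $(0,\alpha)$ to $(2n+\beta-\alpha,\beta)$ using steps $U=(1,1)$ and $D=(1,-1)$ that stay weakly above the line $y=0$ (such paths have exactly $n$ steps $D$). A return to ground is a $D$ step whose right endpoint lies on $y=0$. $C^2_{n,(\alpha,\beta),\rho}$ is the number of such paths with exactly $\rho$ returns to ground. Conventions: an empty sum is $0$; $\binom{a}{b}=0$ whenever $a<0$ or $b<0$, and a term whose binomial coefficient is $0$ is $0$. -}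

module Defs where

open import Data.Bool using (Bool; true; false; _∧_)
open import Data.Nat using (ℕ; zero; suc; _+_; _*_; _∸_; _≡ᵇ_; _⊓_)
open import Data.Nat.Combinatorics using (_C_)
open import Data.Integer as ℤ using (ℤ; +_; -[1+_])
open import Data.Rational as ℚ using (ℚ; _/_)
open import Relation.Nullary.Decidable using (⌊_⌋)
open import Data.List using (List; []; _∷_; map; _++_; length; filterᵇ)

-- Lattice steps U = (1,1), D = (1,-1).
data Step : Set where
  U D : Step

allPaths : ℕ → List (List Step)
allPaths zero    = [] ∷ []
allPaths (suc k) = map (U ∷_) (allPaths k) ++ map (D ∷_) (allPaths k)

staysAbove : ℕ → List Step → Bool
staysAbove h       []      = true
staysAbove h       (U ∷ p) = staysAbove (suc h) p
staysAbove zero    (D ∷ p) = false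
staysAbove (suc h) (D ∷ p) = staysAbove h p

endHeight : ℤ → List Step → ℤ
endHeight h []      = h
endHeight h (U ∷ p) = endHeight (h ℤ.+ ℤ.1ℤ) p
endHeight h (D ∷ p) = endHeight (h ℤ.- ℤ.1ℤ) p

numD : List Step → ℕ
numD []      = 0
numD (U ∷ p) = numD p
numD (D ∷ p) = suc (numD p)

-- Number of returns to ground (D steps whose right endpoint is on y = 0),
-- for a path starting at height h (only meaningful for paths staying
-- weakly above y = 0).
returns : ℕ → List Step → ℕ
returns h             []      = 0
returns h             (U ∷ p) = returns (suc h) p
returns zero          (D ∷ p) = returns zero p
returns (suc zero)    (D ∷ p) = suc (returns zero p)
returns (suc (suc h)) (D ∷ p) = returns (suc h) p

-- Is p a path from (0,α) to (2n+β-α, β) (with n D steps) staying weakly above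
-- y = 0 and having exactly ρ returns to ground?  (Its length is 2n+β-α, which
-- is forced by the height/D-count conditions.)
isC2Path : ℕ → ℕ → ℕ → ℕ → List Step → Bool
isC2Path n α β ρ p =
  staysAbove α p ∧ ⌊ endHeight (+ α) p ℤ.≟ + β ⌋ ∧ (numD p ≡ᵇ n) ∧ (returns α p ≡ᵇ ρ)

-- All candidate paths have
-- 2n+β-α steps; when α > 2n+β no path exists, and then the truncated length
-- 0 gives only the empty path, which fails the conditions (ends at α ≠ β or
-- has 0 ≠ n D steps).
C2 : ℕ → ℕ → ℕ → ℕ → ℕ
C2 n α β ρ = length (filterᵇ (isC2Path n α β ρ) (allPaths ((2 * n + β) ∸ α)))

binomℤ : ℤ → ℤ → ℕ
binomℤ (+ a) (+ b) = a C b
binomℤ _     _     = 0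

-- If
-- top ≤ 0 the term is taken to be 0 (for top < 0 the binomial is 0 by
-- convention; top = 0 never occurs with a nonzero binomial in the statement).
ballotTerm : ℤ → ℤ → ℤ → ℚ
ballotTerm num (+ suc m) bot = (num / suc m) ℚ.* ((+ binomℤ (+ suc m) bot) / 1)
ballotTerm num _         bot = ℚ.0ℚ

sumBelow : ℕ → (ℕ → ℚ) → ℚ
sumBelow zero    f = ℚ.0ℚ
sumBelow (suc k) f = sumBelow k f ℚ.+ f k

-- The ρ = 0 case: Σ_{i=0}^{min(α-1,β-1)} (α+β-1-2i)/(2n+β-α+1) binom(2n+β-α+1, n-α+1+i).
-- For α > 0 the index range 0..min(α-1,β-1) is exactly i < min(α,β)
-- (empty when β = 0).
rhsZero : ℕ → ℕ → ℕ → ℚ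
rhsZero n α β = sumBelow (α ⊓ β) λ i →
  ballotTerm (+ α ℤ.+ + β ℤ.- ℤ.1ℤ ℤ.- + (2 * i))
             (+ (2 * n) ℤ.+ + β ℤ.- + α ℤ.+ ℤ.1ℤ)
             (+ n ℤ.- + α ℤ.+ ℤ.1ℤ ℤ.+ + i)

rhsPos : ℕ → ℕ → ℕ → ℕ → ℚ
rhsPos n α β ρ =
  ballotTerm (+ α ℤ.+ + β ℤ.+ + ρ ℤ.- ℤ.1ℤ)
             (+ (2 * n) ℤ.+ + β ℤ.- + α ℤ.- + ρ ℤ.+ ℤ.1ℤ)
             (+ n ℤ.- + α ℤ.- + ρ ℤ.+ ℤ.1ℤ)

-- Classifying paths by their first step gives a recurrence in the length k for the number of
-- paths from height h with d down steps and r returns.  The reflection-principle closed forms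
--   C(k, d) − C(k, d − h)                                 for r = 0,
--   C(k − r, j) − C(k − r, j − 1),  j = d − h − r + 1      for r > 0,
-- obey the same recurrence by Pascal's rule and agree on the empty path.  The stated formulas
-- are these closed forms: the r > 0 term is a ballot difference because
-- (s − 2j) C(s, j) = s (C(s − 1, j) − C(s − 1, j − 1)), and for r = 0 the sum of ballot
-- differences telescopes to C(L, n) − C(L, n − α), where L = 2n + β − α.
module Submission where

open import Data.Bool using (Bool; true; false; _∧_; if_then_else_)
open import Data.Bool.Properties using (∧-zeroʳ)
open import Data.Empty using (⊥-elim)
open import Data.Integer as ℤ using (ℤ; +_; -[1+_]; 0ℤ; 1ℤ; _+_; _-_; -_; _⊖_)
import Data.Integer.Properties as ℤ
open import Data.Integer.Tactic.RingSolver using (solve-∀)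
open import Data.List using (List; []; _∷_; _++_; map; length; filterᵇ)
open import Data.List.Properties using (filter-++; length-++)
open import Data.Nat as ℕ using (ℕ; zero; suc; _<_)
open import Data.Nat.Combinatorics using (_C_; nCk+nC[k+1]≡[n+1]C[k+1]; nC1≡n; nCk≡nC[n∸k]; k>n⇒nCk≡0)
import Data.Nat.Properties as ℕ
open import Data.Nat.Tactic.RingSolver using () renaming (solve-∀ to ℕ-solve-∀)
open import Data.Product using (_×_; _,_)
open import Data.Rational as ℚ using (ℚ; _/_; toℚᵘ)
open import Data.Rational.Properties using (toℚᵘ-injective; toℚᵘ-fromℚᵘ; toℚᵘ-homo-+; toℚᵘ-homo-*)
open import Data.Rational.Unnormalised as ℚᵘ using (mkℚᵘ; *≡*)
import Data.Rational.Unnormalised.Properties as ℚᵘ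
open import Function using (_∘_)
open import Relation.Binary.PropositionalEquality
open import Relation.Nullary using (Dec; yes; no)
open import Relation.Nullary.Decidable using (⌊_⌋; T?)

open import Defs

countᵇ : {A : Set} → (A → Bool) → List A → ℕ
countᵇ p xs = length (filterᵇ p xs)

countᵇ-++ : {A : Set} (p : A → Bool) (xs ys : List A) →
            countᵇ p (xs ++ ys) ≡ countᵇ p xs ℕ.+ countᵇ p ys
countᵇ-++ p xs ys = trans (cong length (filter-++ (T? ∘ p) xs ys)) (length-++ (filterᵇ p xs))

countᵇ-map : {A B : Set} (p : B → Bool) (q : A → Bool) (f : A → B) →
             (∀ x → p (f x) ≡ q x) → ∀ xs → countᵇ p (map f xs) ≡ countᵇ q xs
countᵇ-map p q f pf≗q []       = refl
countᵇ-map p q f pf≗q (x ∷ xs) rewrite pf≗q x with q x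
... | true  = cong suc (countᵇ-map p q f pf≗q xs)
... | false = countᵇ-map p q f pf≗q xs

countᵇ-false : {A : Set} (xs : List A) → countᵇ (λ _ → false) xs ≡ 0
countᵇ-false []       = refl
countᵇ-false (x ∷ xs) = countᵇ-false xs

∧-false₃ : ∀ a b c → a ∧ (b ∧ (c ∧ false)) ≡ false
∧-false₃ a b c = trans (cong (λ x → a ∧ (b ∧ x)) (∧-zeroʳ c))
                       (trans (cong (a ∧_) (∧-zeroʳ b)) (∧-zeroʳ a))

-- paths k h b d r counts the step sequences of length k that start at height h, stay weakly
-- above 0, end at height b, and have d down steps and r returns to ground.
mutual
  paths : ℕ → ℕ → ℕ → ℕ → ℕ → ℕ
  paths zero    h b zero    zero    = if ⌊ + h ℤ.≟ + b ⌋ then 1 else 0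
  paths zero    h b zero    (suc r) = 0
  paths zero    h b (suc d) r       = 0
  paths (suc k) h b d       r       = paths k (suc h) b d r ℕ.+ pathsAfterDown k h b d r

  pathsAfterDown : ℕ → ℕ → ℕ → ℕ → ℕ → ℕ
  pathsAfterDown k zero          b d       r       = 0
  pathsAfterDown k (suc h)       b zero    r       = 0
  pathsAfterDown k 1             b (suc d) zero    = 0
  pathsAfterDown k 1             b (suc d) (suc r) = paths k 0 b d r
  pathsAfterDown k (suc (suc h)) b (suc d) r       = paths k (suc h) b d r

countᵇ-isC2Path : ∀ k h b d r → countᵇ (isC2Path d h b r) (allPaths k) ≡ paths k h b d r
countᵇ-isC2Path zero h b zero zero with ⌊ + h ℤ.≟ + b ⌋
... | true  = refl
... | false = refl
countᵇ-isC2Path zero h b zero (suc r) with ⌊ + h ℤ.≟ + b ⌋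
... | true  = refl
... | false = refl
countᵇ-isC2Path zero h b (suc d) r with ⌊ + h ℤ.≟ + b ⌋
... | true  = refl
... | false = refl
countᵇ-isC2Path (suc k) h b d r = begin
  countᵇ P (map (U ∷_) A ++ map (D ∷_) A)
    ≡⟨ countᵇ-++ P (map (U ∷_) A) (map (D ∷_) A) ⟩
  countᵇ P (map (U ∷_) A) ℕ.+ countᵇ P (map (D ∷_) A)
    ≡⟨ cong₂ ℕ._+_ (trans (countᵇ-map P _ (U ∷_) up A) (countᵇ-isC2Path k (suc h) b d r))
                   (afterDown h d r) ⟩
  paths k (suc h) b d r ℕ.+ pathsAfterDown k h b d r ∎
  where
  open ≡-Reasoning
  P = isC2Path d h b r
  A = allPaths k
  up : ∀ p → P (U ∷ p) ≡ isC2Path d (suc h) b r p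
  up p = cong (λ h′ → staysAbove (suc h) p ∧ (⌊ endHeight (+ h′) p ℤ.≟ + b ⌋ ∧
                                               ((numD p ℕ.≡ᵇ d) ∧ (returns (suc h) p ℕ.≡ᵇ r))))
              (ℕ.+-comm h 1)
  impossible : ∀ {d r h} → (∀ p → isC2Path d h b r (D ∷ p) ≡ false) →
               countᵇ (isC2Path d h b r) (map (D ∷_) A) ≡ 0
  impossible never = trans (countᵇ-map _ _ (D ∷_) never A) (countᵇ-false A)
  afterDown : ∀ h d r → countᵇ (isC2Path d h b r) (map (D ∷_) A) ≡ pathsAfterDown k h b d r
  afterDown zero          d       r       = impossible λ p → refl
  afterDown (suc h)       zero    r       = impossible λ p →
    ∧-false₃ (staysAbove h p) ⌊ endHeight (+ suc h ℤ.- 1ℤ) p ℤ.≟ + b ⌋ true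
  afterDown 1             (suc d) zero    = impossible λ p →
    ∧-false₃ (staysAbove 0 p) ⌊ endHeight 0ℤ p ℤ.≟ + b ⌋ (numD p ℕ.≡ᵇ d)
  afterDown 1             (suc d) (suc r) =
    trans (countᵇ-map _ _ (D ∷_) (λ p → refl) A) (countᵇ-isC2Path k 0 b d r)
  afterDown (suc (suc h)) (suc d) r       =
    trans (countᵇ-map _ _ (D ∷_) (λ p → refl) A) (countᵇ-isC2Path k (suc h) b d r)

C2≡paths : ∀ n α β ρ → C2 n α β ρ ≡ paths (2 ℕ.* n ℕ.+ β ℕ.∸ α) α β n ρ
C2≡paths n α β ρ = countᵇ-isC2Path (2 ℕ.* n ℕ.+ β ℕ.∸ α) α β n ρ

binom : ℤ → ℤ → ℤ
binom T j = + binomℤ T j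

binomDiff : ℤ → ℤ → ℤ → ℤ
binomDiff T x y = binom T x - binom T y

ballot : ℤ → ℤ → ℤ
ballot T j = binomDiff T j (j - 1ℤ)

binom-negativeBottom : ∀ T m → binom T -[1+ m ] ≡ 0ℤ
binom-negativeBottom (+ t)    m = refl
binom-negativeBottom -[1+ t ] m = refl

ballot-negativeBottom : ∀ T m → ballot T -[1+ m ] ≡ 0ℤ
ballot-negativeBottom (+ t)    m = refl
ballot-negativeBottom -[1+ t ] m = refl

-[1+m]-n≡-[1+m+n] : ∀ m n → -[1+ m ] - + n ≡ -[1+ m ℕ.+ n ]
-[1+m]-n≡-[1+m+n] m zero    = cong -[1+_] (sym (ℕ.+-identityʳ m))
-[1+m]-n≡-[1+m+n] m (suc n) = cong -[1+_] (sym (ℕ.+-suc m n))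

m-n≡-[1+n∸1+m] : ∀ {m n} → m ℕ.< n → + m - + n ≡ -[1+ n ℕ.∸ suc m ]
m-n≡-[1+n∸1+m] {m} {n} m<n = begin
  + m - + n                 ≡⟨ ℤ.m-n≡m⊖n m n ⟩
  m ⊖ n                     ≡⟨ ℤ.⊖-< m<n ⟩
  - + (n ℕ.∸ m)             ≡⟨ cong (λ k → - + k) (ℕ.+-∸-assoc 1 m<n) ⟩
  -[1+ n ℕ.∸ suc m ]        ∎
  where open ≡-Reasoning

binom-belowZero : ∀ T {a c} → a ℕ.< c → binom T (+ a - + c) ≡ 0ℤ
binom-belowZero T a<c = trans (cong (binom T) (m-n≡-[1+n∸1+m] a<c)) (binom-negativeBottom T _)

binom-pascal : ∀ t j → binom (+ suc t) j ≡ binom (+ t) j + binom (+ t) (j - 1ℤ)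
binom-pascal t -[1+ m ]  = refl
binom-pascal t (+ zero)  = refl
binom-pascal t (+ suc j) = begin
  + (suc t C suc j)               ≡⟨ cong +_ (sym (nCk+nC[k+1]≡[n+1]C[k+1] t j)) ⟩
  + (t C j ℕ.+ t C suc j)         ≡⟨ cong +_ (ℕ.+-comm (t C j) (t C suc j)) ⟩
  + (t C suc j ℕ.+ t C j)         ≡⟨ ℤ.pos-+ (t C suc j) (t C j) ⟩
  + (t C suc j) + + (t C j)       ∎
  where open ≡-Reasoning

binomDiff-pascal : ∀ t x y →
  binomDiff (+ suc t) x y ≡ binomDiff (+ t) x (y - 1ℤ) + binomDiff (+ t) (x - 1ℤ) y
binomDiff-pascal t x y rewrite binom-pascal t x | binom-pascal t y =
  regroup (binom (+ t) x) (binom (+ t) (x - 1ℤ)) (binom (+ t) y) (binom (+ t) (y - 1ℤ))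
  where
  regroup : ∀ a a′ b b′ → (a + a′) - (b + b′) ≡ (a - b′) + (a′ - b)
  regroup = solve-∀

-- With binomℤ vanishing on negative tops, Pascal's rule fails only for binom 0 0, so the rule
-- for ballot numbers needs the bottom index to be negative when the top is 0.
ballot-pascal : ∀ {S} T z → S ≡ T + 1ℤ → (S ≡ 0ℤ → z ℤ.< 0ℤ) →
                ballot S z ≡ ballot T (z - 1ℤ) + ballot T z
ballot-pascal (+ t) z refl _ rewrite ℕ.+-comm t 1
                                   | binom-pascal t z | binom-pascal t (z - 1ℤ) =
  regroup (binom (+ t) z) (binom (+ t) (z - 1ℤ)) (binom (+ t) (z - 1ℤ - 1ℤ))
  where
  regroup : ∀ a b c → (a + b) - (b + c) ≡ (b - c) + (a - b)
  regroup = solve-∀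
ballot-pascal -[1+ zero ] -[1+ m ] refl _ = refl
ballot-pascal -[1+ zero ] (+ j) refl z<0 with ℤ.+<+ () ← z<0 refl
ballot-pascal -[1+ suc t ] z refl _ = refl

-- The values of paths k (suc h) b d r, of paths k 0 b d s and of pathsAfterDown k (suc h) b d r;
-- they do not depend on the end height b, which is determined by k + suc h ≡ 2 * d + b.
pathsClosedForm : ℕ → ℕ → ℕ → ℕ → ℤ
pathsClosedForm k h d zero    = binomDiff (+ k) (+ d) (+ d - + suc h)
pathsClosedForm k h d (suc s) = ballot (+ k - + suc s) (+ d - + suc h - + s)

groundClosedForm : ℕ → ℕ → ℕ → ℤ
groundClosedForm zero    zero zero = 1ℤ
groundClosedForm zero    _    _    = 0ℤ
groundClosedForm (suc k) d    s    = pathsClosedForm k 0 d s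

afterDownClosedForm : ℕ → ℕ → ℕ → ℕ → ℤ
afterDownClosedForm k h       zero    r       = 0ℤ
afterDownClosedForm k zero    (suc d) zero    = 0ℤ
afterDownClosedForm k zero    (suc d) (suc s) = groundClosedForm k d s
afterDownClosedForm k (suc h) (suc d) r       = pathsClosedForm k h d r

pathsClosedForm-heightOne : ∀ k d s → pathsClosedForm k 0 d s ≡ ballot (+ k - + s) (+ d - + s)
pathsClosedForm-heightOne k d zero    =
  cong₂ (λ T j → binomDiff T j (j - 1ℤ)) (sym (ℤ.+-identityʳ (+ k))) (sym (ℤ.+-identityʳ (+ d)))
pathsClosedForm-heightOne k d (suc s) = cong (ballot (+ k - + suc s)) (shift (+ d) (+ s))
  where
  shift : ∀ x y → x - 1ℤ - y ≡ x - (1ℤ + y)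
  shift = solve-∀

ballot-belowGround : ∀ T h s → ballot T (+ 0 - + suc h - + s) ≡ 0ℤ
ballot-belowGround T h s rewrite -[1+m]-n≡-[1+m+n] h s = ballot-negativeBottom T (h ℕ.+ s)

length-twoDown : ∀ {m d b} → suc (suc m) ≡ 2 ℕ.* suc d ℕ.+ b → m ≡ 2 ℕ.* d ℕ.+ b
length-twoDown {m} {d} {b} eq = ℕ.suc-injective (ℕ.suc-injective (trans eq (double-suc d b)))
  where
  double-suc : ∀ d b → 2 ℕ.* suc d ℕ.+ b ≡ suc (suc (2 ℕ.* d ℕ.+ b))
  double-suc = ℕ-solve-∀

length-oneStep : ∀ {d b} → 2 ≡ 2 ℕ.* suc d ℕ.+ b → d ≡ 0 × b ≡ 0
length-oneStep {zero} {zero} refl = refl , refl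
length-oneStep {suc d} {b} eq with () ← length-twoDown {0} {suc d} {b} eq

suc<double : ∀ d b → suc d ℕ.< 2 ℕ.* suc d ℕ.+ b
suc<double d b = subst (suc d ℕ.<_) (sym (expand d b)) (ℕ.m≤m+n (suc (suc d)) (d ℕ.+ b))
  where
  expand : ∀ d b → 2 ℕ.* suc d ℕ.+ b ≡ suc (suc d) ℕ.+ (d ℕ.+ b)
  expand = ℕ-solve-∀

m-n-o≡p⇒m≡n+o+p : ∀ d a c e → + d - + a - + c ≡ + e → d ≡ a ℕ.+ c ℕ.+ e
m-n-o≡p⇒m≡n+o+p d a c e eq = ℤ.+-injective (begin
  + d                             ≡⟨ split (+ d) (+ a) (+ c) ⟩
  (+ d - + a - + c) + (+ a + + c) ≡⟨ cong (_+ (+ a + + c)) eq ⟩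
  + e + (+ a + + c)               ≡⟨ ℤ.+-comm (+ e) (+ a + + c) ⟩
  + (a ℕ.+ c ℕ.+ e)               ∎)
  where
  open ≡-Reasoning
  split : ∀ x y z → x ≡ (x - y - z) + (y + z)
  split = solve-∀

-- A path of length suc k from height suc h whose closed form has top index 0 and a
-- nonnegative bottom index is the single step D from height 1.
topZero⇒bottomNegative : ∀ k h d s {b} → k ℕ.+ h ≢ 0 → suc k ℕ.+ suc h ≡ 2 ℕ.* d ℕ.+ b →
                         + suc k - + suc s ≡ 0ℤ → + d - + suc h - + s ℤ.< 0ℤ
topZero⇒bottomNegative k h d s {b} k+h≢0 length≡ top≡0
  with + d - + suc h - + s in bottom≡
... | -[1+ _ ] = ℤ.-<+
... | + e      = ⊥-elim (k+h≢0 (ℕ.m+n≡0⇒m≡0 (k ℕ.+ h) (sym excess≡0)))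
  where
  k≡s : k ≡ s
  k≡s = ℕ.suc-injective (ℤ.+-injective (ℤ.i-j≡0⇒i≡j (+ suc k) (+ suc s) top≡0))
  expand : ∀ k h e b → 2 ℕ.* (suc h ℕ.+ k ℕ.+ e) ℕ.+ b ≡
                       (suc k ℕ.+ suc h) ℕ.+ ((k ℕ.+ h) ℕ.+ (e ℕ.+ e ℕ.+ b))
  expand = ℕ-solve-∀
  excess≡0 : 0 ≡ (k ℕ.+ h) ℕ.+ (e ℕ.+ e ℕ.+ b)
  excess≡0 = ℕ.+-cancelˡ-≡ (suc k ℕ.+ suc h) _ _ (begin
    suc k ℕ.+ suc h ℕ.+ 0   ≡⟨ ℕ.+-identityʳ _ ⟩
    suc k ℕ.+ suc h         ≡⟨ length≡ ⟩
    2 ℕ.* d ℕ.+ b           ≡⟨ cong (λ d → 2 ℕ.* d ℕ.+ b) (m-n-o≡p⇒m≡n+o+p d (suc h) s e bottom≡) ⟩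
    2 ℕ.* (suc h ℕ.+ s ℕ.+ e) ℕ.+ b
                            ≡⟨ cong (λ s → 2 ℕ.* (suc h ℕ.+ s ℕ.+ e) ℕ.+ b) (sym k≡s) ⟩
    2 ℕ.* (suc h ℕ.+ k ℕ.+ e) ℕ.+ b ≡⟨ expand k h e b ⟩
    suc k ℕ.+ suc h ℕ.+ (k ℕ.+ h ℕ.+ (e ℕ.+ e ℕ.+ b)) ∎)
    where open ≡-Reasoning

noReturns-step-fromOne : ∀ k d →
  pathsClosedForm (suc k) 0 (suc d) 0 ≡ pathsClosedForm k 1 (suc d) 0 + 0ℤ
noReturns-step-fromOne k d = begin
  binomDiff (+ suc k) (+ suc d) (+ d)
    ≡⟨ binomDiff-pascal k (+ suc d) (+ d) ⟩
  binomDiff (+ k) (+ suc d) (+ d - 1ℤ) + binomDiff (+ k) (+ d) (+ d)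
    ≡⟨ cong₂ _+_ (cong (binomDiff (+ k) (+ suc d)) (shift (+ d))) (ℤ.+-inverseʳ (binom (+ k) (+ d))) ⟩
  binomDiff (+ k) (+ suc d) (+ suc d - + 2) + 0ℤ ∎
  where
  open ≡-Reasoning
  shift : ∀ x → x - 1ℤ ≡ (1ℤ + x) - (1ℤ + 1ℤ)
  shift = solve-∀
noReturns-step : ∀ k h d → pathsClosedForm (suc k) (suc h) (suc d) 0 ≡
  pathsClosedForm k (suc (suc h)) (suc d) 0 + pathsClosedForm k h d 0
noReturns-step k h d = begin
  binomDiff (+ suc k) (+ suc d) y
    ≡⟨ binomDiff-pascal k (+ suc d) y ⟩
  binomDiff (+ k) (+ suc d) (y - 1ℤ) + binomDiff (+ k) (+ d) y
    ≡⟨ cong₂ _+_ (cong (binomDiff (+ k) (+ suc d)) (shiftUp (+ d) (+ h)))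
                 (cong (binomDiff (+ k) (+ d)) (shiftDown (+ d) (+ h))) ⟩
  binomDiff (+ k) (+ suc d) (+ suc d - + suc (suc (suc h))) + binomDiff (+ k) (+ d) (+ d - + suc h) ∎
  where
  open ≡-Reasoning
  y = + suc d - + suc (suc h)
  shiftUp : ∀ x c → (1ℤ + x) - (1ℤ + (1ℤ + c)) - 1ℤ ≡ (1ℤ + x) - (1ℤ + (1ℤ + (1ℤ + c)))
  shiftUp = solve-∀
  shiftDown : ∀ x c → (1ℤ + x) - (1ℤ + (1ℤ + c)) ≡ x - (1ℤ + c)
  shiftDown = solve-∀
returns-step-fromOne : ∀ {b} k d s → suc (suc k) ℕ.+ 1 ≡ 2 ℕ.* suc d ℕ.+ b →
  pathsClosedForm (suc (suc k)) 0 (suc d) (suc s) ≡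
  pathsClosedForm (suc k) 1 (suc d) (suc s) + pathsClosedForm k 0 d s
returns-step-fromOne k d s length≡ = begin
  ballot S z
    ≡⟨ ballot-pascal T z (topStep (+ k) (+ s))
         (topZero⇒bottomNegative (suc k) 0 (suc d) s (λ ()) length≡) ⟩
  ballot T (z - 1ℤ) + ballot T z
    ≡⟨ cong₂ _+_ (cong (ballot T) (shiftUp (+ d) (+ s)))
                 (trans (cong₂ ballot (topDown (+ k) (+ s)) (shiftDown (+ d) (+ s)))
                        (sym (pathsClosedForm-heightOne k d s))) ⟩
  ballot T (+ suc d - + 2 - + s) + pathsClosedForm k 0 d s ∎
  where
  open ≡-Reasoning
  S = + suc (suc k) - + suc s
  T = + suc k - + suc s
  z = + suc d - + 1 - + s
  topStep : ∀ x c → (1ℤ + (1ℤ + x)) - (1ℤ + c) ≡ ((1ℤ + x) - (1ℤ + c)) + 1ℤ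
  topStep = solve-∀
  topDown : ∀ x c → (1ℤ + x) - (1ℤ + c) ≡ x - c
  topDown = solve-∀
  shiftUp : ∀ x c → (1ℤ + x) - 1ℤ - c - 1ℤ ≡ (1ℤ + x) - (1ℤ + 1ℤ) - c
  shiftUp = solve-∀
  shiftDown : ∀ x c → (1ℤ + x) - 1ℤ - c ≡ x - c
  shiftDown = solve-∀
returns-step : ∀ {b} k h d s → suc k ℕ.+ suc (suc h) ≡ 2 ℕ.* suc d ℕ.+ b →
  pathsClosedForm (suc k) (suc h) (suc d) (suc s) ≡
  pathsClosedForm k (suc (suc h)) (suc d) (suc s) + pathsClosedForm k h d (suc s)
returns-step k h d s length≡ = begin
  ballot S z
    ≡⟨ ballot-pascal T z (topStep (+ k) (+ s))
         (topZero⇒bottomNegative k (suc h) (suc d) s (ℕ.m+1+n≢0 k) length≡) ⟩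
  ballot T (z - 1ℤ) + ballot T z
    ≡⟨ cong₂ _+_ (cong (ballot T) (shiftUp (+ d) (+ h) (+ s)))
                 (cong (ballot T) (shiftDown (+ d) (+ h) (+ s))) ⟩
  ballot T (+ suc d - + suc (suc (suc h)) - + s) + ballot T (+ d - + suc h - + s) ∎
  where
  open ≡-Reasoning
  S = + suc k - + suc s
  T = + k - + suc s
  z = + suc d - + suc (suc h) - + s
  topStep : ∀ x c → (1ℤ + x) - (1ℤ + c) ≡ (x - (1ℤ + c)) + 1ℤ
  topStep = solve-∀
  shiftUp : ∀ x a c → (1ℤ + x) - (1ℤ + (1ℤ + a)) - c - 1ℤ ≡ (1ℤ + x) - (1ℤ + (1ℤ + (1ℤ + a))) - c
  shiftUp = solve-∀
  shiftDown : ∀ x a c → (1ℤ + x) - (1ℤ + (1ℤ + a)) - c ≡ x - (1ℤ + a) - c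
  shiftDown = solve-∀

pathsClosedForm-step : ∀ {b} k h d r → suc k ℕ.+ suc h ≡ 2 ℕ.* d ℕ.+ b →
  pathsClosedForm (suc k) h d r ≡ pathsClosedForm k (suc h) d r + afterDownClosedForm k h d r
pathsClosedForm-step k       h       zero    zero    length≡ = refl
pathsClosedForm-step k       h       zero    (suc s) length≡ =
  trans (ballot-belowGround (+ suc k - + suc s) h s)
        (cong (_+ 0ℤ) (sym (ballot-belowGround (+ k - + suc s) (suc h) s)))
pathsClosedForm-step k       zero    (suc d) zero    length≡ = noReturns-step-fromOne k d
pathsClosedForm-step k       (suc h) (suc d) zero    length≡ = noReturns-step k h d
pathsClosedForm-step zero    zero    (suc d) (suc s) length≡
  with refl , _ ← length-oneStep {d} length≡ with s
... | zero  = refl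
... | suc _ = refl
pathsClosedForm-step (suc k) zero    (suc d) (suc s) length≡ = returns-step-fromOne k d s length≡
pathsClosedForm-step k       (suc h) (suc d) (suc s) length≡ = returns-step k h d s length≡

paths-empty : ∀ h b d r → suc h ≡ 2 ℕ.* d ℕ.+ b → + paths 0 (suc h) b d r ≡ pathsClosedForm 0 h d r
paths-empty h .(suc h) zero zero refl rewrite ≡-≟-identity ℤ._≟_ (refl {x = + suc h}) = refl
paths-empty h b (suc d) zero length≡
  rewrite binom-belowZero (+ 0) (subst (suc d ℕ.<_) (sym length≡) (suc<double d b)) = refl
paths-empty h b zero    (suc s) length≡ = refl
paths-empty h b (suc d) (suc s) length≡ = refl

mutual
  paths≡closedForm : ∀ k h b d r → k ℕ.+ suc h ≡ 2 ℕ.* d ℕ.+ b →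
                     + paths k (suc h) b d r ≡ pathsClosedForm k h d r
  paths≡closedForm zero    h b d r length≡ = paths-empty h b d r length≡
  paths≡closedForm (suc k) h b d r length≡ = begin
    + (paths k (suc (suc h)) b d r ℕ.+ pathsAfterDown k (suc h) b d r)
      ≡⟨ ℤ.pos-+ (paths k (suc (suc h)) b d r) (pathsAfterDown k (suc h) b d r) ⟩
    + paths k (suc (suc h)) b d r + + pathsAfterDown k (suc h) b d r
      ≡⟨ cong₂ _+_ (paths≡closedForm k (suc h) b d r (trans (ℕ.+-suc k (suc h)) length≡))
                   (pathsAfterDown≡closedForm k h b d r length≡) ⟩
    pathsClosedForm k (suc h) d r + afterDownClosedForm k h d r
      ≡⟨ pathsClosedForm-step k h d r length≡ ⟨
    pathsClosedForm (suc k) h d r ∎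
    where open ≡-Reasoning

  pathsAfterDown≡closedForm : ∀ k h b d r → suc k ℕ.+ suc h ≡ 2 ℕ.* d ℕ.+ b →
                              + pathsAfterDown k (suc h) b d r ≡ afterDownClosedForm k h d r
  pathsAfterDown≡closedForm k       h       b zero    r       length≡ = refl
  pathsAfterDown≡closedForm k       zero    b (suc d) zero    length≡ = refl
  pathsAfterDown≡closedForm zero    zero    b (suc d) (suc s) length≡
    with refl , refl ← length-oneStep {d} length≡ with s
  ... | zero  = refl
  ... | suc _ = refl
  pathsAfterDown≡closedForm (suc k) zero    b (suc d) (suc s) length≡ =
    trans (cong +_ (ℕ.+-identityʳ (paths k 1 b d s)))
          (paths≡closedForm k 0 b d s (length-twoDown {d = d} length≡))
  pathsAfterDown≡closedForm k       (suc h) b (suc d) r       length≡ =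
    paths≡closedForm k h b d r (length-twoDown {d = d} (trans (sym (ℕ.+-suc (suc k) (suc h))) length≡))

toℚᵘ-/ : ∀ a m → toℚᵘ (a / suc m) ℚᵘ.≃ mkℚᵘ a m
toℚᵘ-/ a m = toℚᵘ-fromℚᵘ (mkℚᵘ a m)

/1-homo-+ : ∀ a b → (a / 1) ℚ.+ (b / 1) ≡ (a + b) / 1
/1-homo-+ a b = toℚᵘ-injective (begin-equality
  toℚᵘ ((a / 1) ℚ.+ (b / 1))       ≃⟨ toℚᵘ-homo-+ (a / 1) (b / 1) ⟩
  toℚᵘ (a / 1) ℚᵘ.+ toℚᵘ (b / 1)   ≃⟨ ℚᵘ.+-cong (toℚᵘ-/ a 0) (toℚᵘ-/ b 0) ⟩
  mkℚᵘ a 0 ℚᵘ.+ mkℚᵘ b 0           ≃⟨ *≡* (identity a b) ⟩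
  mkℚᵘ (a + b) 0                   ≃⟨ toℚᵘ-/ (a + b) 0 ⟨
  toℚᵘ ((a + b) / 1)               ∎)
  where
  open ℚᵘ.≤-Reasoning
  identity : ∀ a b → (a ℤ.* 1ℤ + b ℤ.* 1ℤ) ℤ.* 1ℤ ≡ (a + b) ℤ.* 1ℤ
  identity = solve-∀

/-*-/1 : ∀ x m y z → x ℤ.* y ≡ + suc m ℤ.* z → (x / suc m) ℚ.* (y / 1) ≡ z / 1
/-*-/1 x m y z eq = toℚᵘ-injective (begin-equality
  toℚᵘ ((x / suc m) ℚ.* (y / 1))      ≃⟨ toℚᵘ-homo-* (x / suc m) (y / 1) ⟩
  toℚᵘ (x / suc m) ℚᵘ.* toℚᵘ (y / 1)  ≃⟨ ℚᵘ.*-cong (toℚᵘ-/ x m) (toℚᵘ-/ y 0) ⟩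
  mkℚᵘ x m ℚᵘ.* mkℚᵘ y 0              ≃⟨ *≡* cross ⟩
  mkℚᵘ z 0                            ≃⟨ toℚᵘ-/ z 0 ⟨
  toℚᵘ (z / 1)                        ∎)
  where
  open ℚᵘ.≤-Reasoning
  cross : x ℤ.* y ℤ.* 1ℤ ≡ z ℤ.* + suc (m ℕ.* 1)
  cross = trans (ℤ.*-identityʳ (x ℤ.* y)) (trans eq (trans (ℤ.*-comm (+ suc m) z)
                (cong (λ k → z ℤ.* + suc k) (sym (ℕ.*-identityʳ m)))))

absorption : ∀ t j → suc j ℕ.* (suc t C suc j) ≡ suc t ℕ.* (t C j)
absorption zero    zero    = refl
absorption zero    (suc j) = ℕ.*-zeroʳ (suc (suc j))
absorption (suc t) zero    = trans (ℕ.*-identityˡ _) (trans (nC1≡n (suc (suc t))) (sym (ℕ.*-identityʳ _)))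
absorption (suc t) (suc j) = begin
  suc (suc j) ℕ.* (suc (suc t) C suc (suc j))
    ≡⟨ cong (suc (suc j) ℕ.*_) (nCk+nC[k+1]≡[n+1]C[k+1] (suc t) (suc j)) ⟨
  suc (suc j) ℕ.* (A ℕ.+ B)                    ≡⟨ split j A B ⟩
  A ℕ.+ suc j ℕ.* A ℕ.+ suc (suc j) ℕ.* B
    ≡⟨ cong₂ (λ u v → A ℕ.+ u ℕ.+ v) (absorption t j) (absorption t (suc j)) ⟩
  A ℕ.+ suc t ℕ.* (t C j) ℕ.+ suc t ℕ.* (t C suc j)
    ≡⟨ merge A (suc t) (t C j) (t C suc j) ⟩
  A ℕ.+ suc t ℕ.* (t C j ℕ.+ t C suc j)
    ≡⟨ cong (λ u → A ℕ.+ suc t ℕ.* u) (nCk+nC[k+1]≡[n+1]C[k+1] t j) ⟩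
  suc (suc t) ℕ.* A                            ∎
  where
  open ≡-Reasoning
  A = suc t C suc j
  B = suc t C suc (suc j)
  split : ∀ j A B → suc (suc j) ℕ.* (A ℕ.+ B) ≡ A ℕ.+ suc j ℕ.* A ℕ.+ suc (suc j) ℕ.* B
  split = ℕ-solve-∀
  merge : ∀ A s X Y → A ℕ.+ s ℕ.* X ℕ.+ s ℕ.* Y ≡ A ℕ.+ s ℕ.* (X ℕ.+ Y)
  merge = ℕ-solve-∀

binom-weighted≡ballot : ∀ t j → (+ suc t - (j + j)) ℤ.* binom (+ suc t) j ≡ + suc t ℤ.* ballot (+ t) j
binom-weighted≡ballot t -[1+ m ]  = trans (ℤ.*-zeroʳ (+ suc t - (-[1+ m ] + -[1+ m ]))) (sym (ℤ.*-zeroʳ (+ suc t)))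
binom-weighted≡ballot t (+ zero)  = trivial (+ suc t)
  where
  trivial : ∀ s → (s - (0ℤ + 0ℤ)) ℤ.* 1ℤ ≡ s ℤ.* (1ℤ - 0ℤ)
  trivial = solve-∀
binom-weighted≡ballot t (+ suc j) = begin
  (s - (c + c)) ℤ.* Q                      ≡⟨ expand s c Q ⟩
  s ℤ.* Q - c ℤ.* Q - c ℤ.* Q              ≡⟨ cong (λ w → s ℤ.* Q - w - w) cQ≡sB ⟩
  s ℤ.* Q - s ℤ.* B - s ℤ.* B              ≡⟨ cong (λ w → s ℤ.* w - s ℤ.* B - s ℤ.* B) (binom-pascal t (+ suc j)) ⟩
  s ℤ.* (A + B) - s ℤ.* B - s ℤ.* B        ≡⟨ collect s A B ⟩
  s ℤ.* (A - B)                            ∎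
  where
  open ≡-Reasoning
  s = + suc t
  c = + suc j
  Q = binom (+ suc t) (+ suc j)
  A = + (t C suc j)
  B = + (t C j)
  cQ≡sB : c ℤ.* Q ≡ s ℤ.* B
  cQ≡sB = trans (sym (ℤ.pos-* (suc j) (suc t C suc j)))
                (trans (cong +_ (absorption t j)) (ℤ.pos-* (suc t) (t C j)))
  expand : ∀ s c Q → (s - (c + c)) ℤ.* Q ≡ s ℤ.* Q - c ℤ.* Q - c ℤ.* Q
  expand = solve-∀
  collect : ∀ s A B → s ℤ.* (A + B) - s ℤ.* B - s ℤ.* B ≡ s ℤ.* (A - B)
  collect = solve-∀

ballotTerm≡ballot : ∀ T j num → num ≡ T + 1ℤ - (j + j) → ballotTerm num (T + 1ℤ) j ≡ ballot T j / 1
ballotTerm≡ballot (+ t) j num num≡ rewrite ℕ.+-comm t 1 =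
  /-*-/1 num t (binom (+ suc t) j) (ballot (+ t) j)
         (trans (cong (ℤ._* binom (+ suc t) j) num≡) (binom-weighted≡ballot t j))
ballotTerm≡ballot -[1+ zero ]  j num num≡ = refl
ballotTerm≡ballot -[1+ suc m ] j num num≡ = refl

sumBelow-cong : ∀ K {f g : ℕ → ℚ} → (∀ i → f i ≡ g i) → sumBelow K f ≡ sumBelow K g
sumBelow-cong zero    f≗g = refl
sumBelow-cong (suc K) f≗g = cong₂ ℚ._+_ (sumBelow-cong K f≗g) (f≗g K)

sumBelow-telescope : ∀ (f : ℕ → ℤ) K → sumBelow K (λ i → (f (suc i) - f i) / 1) ≡ (f K - f 0) / 1
sumBelow-telescope f zero    rewrite ℤ.+-inverseʳ (f 0) = refl
sumBelow-telescope f (suc K) = begin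
  sumBelow K (λ i → (f (suc i) - f i) / 1) ℚ.+ (f (suc K) - f K) / 1
    ≡⟨ cong (ℚ._+ (f (suc K) - f K) / 1) (sumBelow-telescope f K) ⟩
  (f K - f 0) / 1 ℚ.+ (f (suc K) - f K) / 1
    ≡⟨ /1-homo-+ (f K - f 0) (f (suc K) - f K) ⟩
  ((f K - f 0) + (f (suc K) - f K)) / 1
    ≡⟨ cong (_/ 1) (cancel (f 0) (f K) (f (suc K))) ⟩
  (f (suc K) - f 0) / 1 ∎
  where
  open ≡-Reasoning
  cancel : ∀ a b c → (b - a) + (c - b) ≡ c - a
  cancel = solve-∀

+[2*n]≡+n++n : ∀ n → + (2 ℕ.* n) ≡ + n + + n
+[2*n]≡+n++n n = trans (cong (λ m → + (n ℕ.+ m)) (ℕ.+-identityʳ n)) (ℤ.pos-+ n n)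

rhsZero≡binomDiff : ∀ n α β → rhsZero n α β ≡
  binomDiff (+ (2 ℕ.* n) + + β - + α) (+ n - + α + + (α ℕ.⊓ β)) (+ n - + α) / 1
rhsZero≡binomDiff n α β = begin
  rhsZero n α β                                          ≡⟨ sumBelow-cong (α ℕ.⊓ β) term≡ ⟩
  sumBelow (α ℕ.⊓ β) (λ i → (f (suc i) - f i) / 1)     ≡⟨ sumBelow-telescope f (α ℕ.⊓ β) ⟩
  (f (α ℕ.⊓ β) - f 0) / 1                              ≡⟨ cong (λ j → (f (α ℕ.⊓ β) - binom T j) / 1)
                                                                 (ℤ.+-identityʳ (+ n - + α)) ⟩
  binomDiff T (+ n - + α + + (α ℕ.⊓ β)) (+ n - + α) / 1 ∎
  where
  open ≡-Reasoning
  T = + (2 ℕ.* n) + + β - + α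
  f : ℕ → ℤ
  f i = binom T (+ n - + α + + i)
  numerator : ∀ a b n i → a + b - 1ℤ - (i + i) ≡
              (n + n + b - a + 1ℤ) - ((n - a + 1ℤ + i) + (n - a + 1ℤ + i))
  numerator = solve-∀
  shift : ∀ x i → x + 1ℤ + i ≡ x + (1ℤ + i)
  shift = solve-∀
  unshift : ∀ x i → x + 1ℤ + i - 1ℤ ≡ x + i
  unshift = solve-∀
  term≡ : ∀ i → ballotTerm (+ α + + β - 1ℤ - + (2 ℕ.* i)) (T + 1ℤ) (+ n - + α + 1ℤ + + i) ≡
                (f (suc i) - f i) / 1
  term≡ i = trans
    (ballotTerm≡ballot T _ _ (trans (cong (λ m → + α + + β - 1ℤ - m) (+[2*n]≡+n++n i))
      (trans (numerator (+ α) (+ β) (+ n) (+ i))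
             (cong (λ m → (m + + β - + α + 1ℤ) - (j + j)) (sym (+[2*n]≡+n++n n))))))
    (cong (_/ 1) (cong₂ (λ x y → binom T x - binom T y)
                        (shift (+ n - + α) (+ i)) (unshift (+ n - + α) (+ i))))
    where
    j = + n - + α + 1ℤ + + i

rhsPos≡ballot : ∀ n α β s → rhsPos n α β (suc s) ≡
  ballot (+ (2 ℕ.* n) + + β - + α - + suc s) (+ n - + α - + s) / 1
rhsPos≡ballot n α β s = trans
  (ballotTerm≡ballot (T - + suc s) _ _ (trans (numerator (+ α) (+ β) (+ n) (+ s))
    (cong (λ m → (m + + β - + α - + suc s + 1ℤ) - (j + j)) (sym (+[2*n]≡+n++n n)))))
  (cong (λ j → ballot (T - + suc s) j / 1) (shift (+ n - + α) (+ s)))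
  where
  T = + (2 ℕ.* n) + + β - + α
  j = + n - + α - + suc s + 1ℤ
  numerator : ∀ a b n s → a + b + (1ℤ + s) - 1ℤ ≡
              (n + n + b - a - (1ℤ + s) + 1ℤ) - ((n - a - (1ℤ + s) + 1ℤ) + (n - a - (1ℤ + s) + 1ℤ))
  numerator = solve-∀
  shift : ∀ x s → x - (1ℤ + s) + 1ℤ ≡ x - s
  shift = solve-∀

binom-sym : ∀ L j → binom (+ L) j ≡ binom (+ L) (+ L - j)
binom-sym L -[1+ m ] = sym (cong +_ (k>n⇒nCk≡0 (ℕ.m<m+n L (ℕ.s≤s ℕ.z≤n))))
binom-sym L (+ a) with a ℕ.≤? L
... | yes a≤L = trans (cong +_ (nCk≡nC[n∸k] a≤L))
                      (cong (binom (+ L)) (sym (trans (ℤ.m-n≡m⊖n L a) (ℤ.⊖-≥ a≤L))))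
... | no  a≰L = trans (cong +_ (k>n⇒nCk≡0 (ℕ.≰⇒> a≰L))) (sym (binom-belowZero (+ L) (ℕ.≰⇒> a≰L)))

+L≡top : ∀ L n α β → L ℕ.+ α ≡ 2 ℕ.* n ℕ.+ β → + L ≡ + (2 ℕ.* n) + + β - + α
+L≡top L n α β L+α≡ = begin
  + L                         ≡⟨ cancel (+ L) (+ α) ⟩
  + L + + α - + α             ≡⟨ cong (_- + α) (ℤ.pos-+ L α) ⟨
  + (L ℕ.+ α) - + α           ≡⟨ cong (λ m → + m - + α) L+α≡ ⟩
  + (2 ℕ.* n ℕ.+ β) - + α     ≡⟨ cong (_- + α) (ℤ.pos-+ (2 ℕ.* n) β) ⟩
  + (2 ℕ.* n) + + β - + α     ∎
  where
  open ≡-Reasoning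
  cancel : ∀ x y → x ≡ x + y - y
  cancel = solve-∀

-- For β < α the last index n − α + β of the telescoped sum is the reflection L − n of n.
binom-lastIndex : ∀ L n α β → L ℕ.+ α ≡ 2 ℕ.* n ℕ.+ β →
                  binom (+ L) (+ n - + α + + (α ℕ.⊓ β)) ≡ binom (+ L) (+ n)
binom-lastIndex L n α β L+α≡ with α ℕ.≤? β
... | yes α≤β rewrite ℕ.m≤n⇒m⊓n≡m α≤β = cong (binom (+ L)) (cancel (+ n) (+ α))
  where
  cancel : ∀ x y → x - y + y ≡ x
  cancel = solve-∀
... | no  α≰β rewrite ℕ.m≥n⇒m⊓n≡n (ℕ.<⇒≤ (ℕ.≰⇒> α≰β)) =
  trans (binom-sym L j) (cong (binom (+ L)) (trans (cong (_- j) +L≡) (reflect (+ n) (+ α) (+ β))))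
  where
  j = + n - + α + + β
  +L≡ : + L ≡ + n + + n + + β - + α
  +L≡ = trans (+L≡top L n α β L+α≡) (cong (λ m → m + + β - + α) (+[2*n]≡+n++n n))
  reflect : ∀ x a b → (x + x + b - a) - (x - a + b) ≡ x
  reflect = solve-∀

C2≡closedForm : ∀ n h β ρ → suc h ℕ.≤ 2 ℕ.* n ℕ.+ β →
                + C2 n (suc h) β ρ ≡ pathsClosedForm (2 ℕ.* n ℕ.+ β ℕ.∸ suc h) h n ρ
C2≡closedForm n h β ρ α≤ = trans (cong +_ (C2≡paths n (suc h) β ρ))
  (paths≡closedForm (2 ℕ.* n ℕ.+ β ℕ.∸ suc h) h β n ρ (ℕ.m∸n+n≡m α≤))

C2-vanishes : ∀ n α β ρ → 2 ℕ.* n ℕ.+ β ℕ.< α → (+ C2 n α β ρ) / 1 ≡ ℚ.0ℚ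
C2-vanishes n α β ρ short rewrite C2≡paths n α β ρ | ℕ.m≤n⇒m∸n≡0 (ℕ.<⇒≤ short) =
  cong (λ c → + c / 1) (empty n ρ)
  where
  β<α : β ℕ.< α
  β<α = ℕ.≤-<-trans (ℕ.m≤n+m β (2 ℕ.* n)) short
  empty : ∀ d r → paths 0 α β d r ≡ 0
  empty zero zero rewrite ≢-≟-identity ℤ._≟_ (ℕ.>⇒≢ β<α ∘ ℤ.+-injective) = refl
  empty zero (suc r) = refl
  empty (suc d) r = refl

top-negative : ∀ n α β → 2 ℕ.* n ℕ.+ β ℕ.< α →
               + (2 ℕ.* n) + + β - + α ≡ -[1+ α ℕ.∸ suc (2 ℕ.* n ℕ.+ β) ]
top-negative n α β short = trans (cong (_- + α) (sym (ℤ.pos-+ (2 ℕ.* n) β))) (m-n≡-[1+n∸1+m] short)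

C2≡rhsZero-≤ : ∀ n h β → suc h ℕ.≤ 2 ℕ.* n ℕ.+ β → (+ C2 n (suc h) β 0) / 1 ≡ rhsZero n (suc h) β
C2≡rhsZero-≤ n h β α≤ = begin
  + C2 n (suc h) β 0 / 1                               ≡⟨ cong (_/ 1) (C2≡closedForm n h β 0 α≤) ⟩
  binomDiff (+ L) (+ n) (+ n - + suc h) / 1
    ≡⟨ cong (λ x → (x - binom (+ L) (+ n - + suc h)) / 1) (binom-lastIndex L n (suc h) β L+α≡) ⟨
  binomDiff (+ L) (+ n - + suc h + + (suc h ℕ.⊓ β)) (+ n - + suc h) / 1
    ≡⟨ cong (λ T → binomDiff T (+ n - + suc h + + (suc h ℕ.⊓ β)) (+ n - + suc h) / 1) (+L≡top L n (suc h) β L+α≡) ⟩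
  binomDiff T (+ n - + suc h + + (suc h ℕ.⊓ β)) (+ n - + suc h) / 1 ≡⟨ rhsZero≡binomDiff n (suc h) β ⟨
  rhsZero n (suc h) β ∎
  where
  open ≡-Reasoning
  L = 2 ℕ.* n ℕ.+ β ℕ.∸ suc h
  T = + (2 ℕ.* n) + + β - + suc h
  L+α≡ = ℕ.m∸n+n≡m α≤

C2≡rhsPos-≤ : ∀ n h β s → suc h ℕ.≤ 2 ℕ.* n ℕ.+ β →
              (+ C2 n (suc h) β (suc s)) / 1 ≡ rhsPos n (suc h) β (suc s)
C2≡rhsPos-≤ n h β s α≤ = begin
  + C2 n (suc h) β (suc s) / 1                                  ≡⟨ cong (_/ 1) (C2≡closedForm n h β (suc s) α≤) ⟩
  ballot (+ L - + suc s) (+ n - + suc h - + s) / 1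
    ≡⟨ cong (λ T → ballot (T - + suc s) (+ n - + suc h - + s) / 1) (+L≡top L n (suc h) β (ℕ.m∸n+n≡m α≤)) ⟩
  ballot (+ (2 ℕ.* n) + + β - + suc h - + suc s) (+ n - + suc h - + s) / 1 ≡⟨ rhsPos≡ballot n (suc h) β s ⟨
  rhsPos n (suc h) β (suc s) ∎
  where
  open ≡-Reasoning
  L = 2 ℕ.* n ℕ.+ β ℕ.∸ suc h

rhsZero-vanishes : ∀ n α β → 2 ℕ.* n ℕ.+ β ℕ.< α → rhsZero n α β ≡ ℚ.0ℚ
rhsZero-vanishes n α β short rewrite rhsZero≡binomDiff n α β | top-negative n α β short = refl

rhsPos-vanishes : ∀ n α β s → 2 ℕ.* n ℕ.+ β ℕ.< α → rhsPos n α β (suc s) ≡ ℚ.0ℚ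
rhsPos-vanishes n α β s short
  rewrite rhsPos≡ballot n α β s | top-negative n α β short = refl

C2≡rhsZero : ∀ n h β → Dec (suc h ℕ.≤ 2 ℕ.* n ℕ.+ β) → (+ C2 n (suc h) β 0) / 1 ≡ rhsZero n (suc h) β
C2≡rhsZero n h β (yes α≤) = C2≡rhsZero-≤ n h β α≤
C2≡rhsZero n h β (no  α≰) =
  trans (C2-vanishes n (suc h) β 0 (ℕ.≰⇒> α≰)) (sym (rhsZero-vanishes n (suc h) β (ℕ.≰⇒> α≰)))

C2≡rhsPos : ∀ n h β s → Dec (suc h ℕ.≤ 2 ℕ.* n ℕ.+ β) →
            (+ C2 n (suc h) β (suc s)) / 1 ≡ rhsPos n (suc h) β (suc s)
C2≡rhsPos n h β s (yes α≤) = C2≡rhsPos-≤ n h β s α≤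
C2≡rhsPos n h β s (no  α≰) =
  trans (C2-vanishes n (suc h) β (suc s) (ℕ.≰⇒> α≰)) (sym (rhsPos-vanishes n (suc h) β s (ℕ.≰⇒> α≰)))

corollary3p12 : (β n ρ α : ℕ) → 0 < α →
    (ρ ≡ 0 → (+ C2 n α β ρ) / 1 ≡ rhsZero n α β)
    × (0 < ρ → (+ C2 n α β ρ) / 1 ≡ rhsPos n α β ρ)
corollary3p12 β n zero    (suc h) _ = (λ _ → C2≡rhsZero n h β (suc h ℕ.≤? 2 ℕ.* n ℕ.+ β)) , λ ()
corollary3p12 β n (suc s) (suc h) _ = (λ ()) , λ _ → C2≡rhsPos n h β s (suc h ℕ.≤? 2 ℕ.* n ℕ.+ β)
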